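{- Let $\mathcal{S}=\langle\mathcal{L},\vdash\rangle$ be a logical structure and $\varrho,\sigma\subseteq\mathcal{P}(\mathcal{L})\times\mathcal{L}$. If $\sigma$ is downward directed, then $(\vdash^\varrho)^\sigma\,\subseteq\,(\vdash^\sigma)^\varrho$. Consequently, if both $\varrho$ and $\sigma$ are downward directed, then $(\vdash^\varrho)^\sigma=(\vdash^\sigma)^\varrho$.
   Context: A logical structure is a pair $\langle\mathcal{L},\vdash\rangle$ with $\mathcal{L}$ a set and $\vdash\,\subseteq\mathcal{P}(\mathcal{L})\times\mathcal{L}$ arbitrary. For $\varrho\subseteq\mathcal{P}(\mathcal{L})\times\mathcal{L}$, the $\varrho$-companion relation is: $\Gamma\vdash^\varrho\alpha$ iff there is $\Delta\subseteq\Gamma$ with $(\Delta,\alpha)\in\varrho$ and $\Delta\vdash\alpha$; $(\vdash^\varrho)^\sigma$ is the $\sigma$-companion of $\langle\mathcal{L},\vdash^\varrho\rangle$. A relation $\varrho\subseteq\mathcal{P}(\mathcal{L})\times\mathcal{L}$ is downward directed if $(\Delta,\alpha)\in\varrho$ implies $(\Delta',\alpha)\in\varrho$ for every $\Delta'\subseteq\Delta$. -}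

module Defs where

open import Level using (Level; suc; _⊔_)
open import Relation.Unary using (Pred; _⊆_)
open import Data.Product using (Σ-syntax; _×_)

Rel𝒫 : ∀ {a} (L : Set a) (ℓ r : Level) → Set (a ⊔ suc ℓ ⊔ suc r)
Rel𝒫 L ℓ r = Pred L ℓ → L → Set r

-- ϱ-companion: Γ ⊢^ϱ α iff ∃ Δ ⊆ Γ with (Δ, α) ∈ ϱ and Δ ⊢ α.
companion : ∀ {a ℓ r s} {L : Set a} → Rel𝒫 L ℓ r → Rel𝒫 L ℓ s → Rel𝒫 L ℓ (a ⊔ suc ℓ ⊔ r ⊔ s)
companion ⊢ ϱ Γ α = Σ[ Δ ∈ Pred _ _ ] ((Δ ⊆ Γ) × ϱ Δ α × ⊢ Δ α)

_⊆ᴿ_ : ∀ {a ℓ r s} {L : Set a} → Rel𝒫 L ℓ r → Rel𝒫 L ℓ s → Set (a ⊔ suc ℓ ⊔ r ⊔ s)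
R ⊆ᴿ S = ∀ Γ α → R Γ α → S Γ α

_≐ᴿ_ : ∀ {a ℓ r s} {L : Set a} → Rel𝒫 L ℓ r → Rel𝒫 L ℓ s → Set (a ⊔ suc ℓ ⊔ r ⊔ s)
R ≐ᴿ S = (R ⊆ᴿ S) × (S ⊆ᴿ R)

DownwardDirected : ∀ {a ℓ r} {L : Set a} → Rel𝒫 L ℓ r → Set (a ⊔ suc ℓ ⊔ r)
DownwardDirected ϱ = ∀ Δ Δ' α → ϱ Δ α → Δ' ⊆ Δ → ϱ Δ' α

-- A witness Δ ⊆ Γ for Γ (⊢^ϱ)^σ α carries a smaller witness Δ' ⊆ Δ with (Δ', α) ∈ ϱ and Δ' ⊢ α.
-- Downward directedness of σ moves (Δ, α) ∈ σ down to (Δ', α) ∈ σ, so Δ' is its own witness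
-- for Δ' ⊢^σ α, and hence witnesses Γ (⊢^σ)^ϱ α.

module Submission where

open import Defs
open import Data.Product using (_×_; _,_)
open import Relation.Unary.Properties using (⊆-refl; ⊆-trans)

companion-self : ∀ {a ℓ t r} {L : Set a} (⊢ : Rel𝒫 L ℓ t) (ϱ : Rel𝒫 L ℓ r)
  → ∀ {Δ α} → ϱ Δ α → ⊢ Δ α → companion ⊢ ϱ Δ α
companion-self ⊢ ϱ {Δ} ϱΔ ⊢Δ = Δ , ⊆-refl {x = Δ} , ϱΔ , ⊢Δ

companion-swap-⊆ : ∀ {a ℓ t r s} {L : Set a} (⊢ : Rel𝒫 L ℓ t) (ϱ : Rel𝒫 L ℓ r) (σ : Rel𝒫 L ℓ s)
  → DownwardDirected σ → companion (companion ⊢ ϱ) σ ⊆ᴿ companion (companion ⊢ σ) ϱ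
companion-swap-⊆ ⊢ ϱ σ σ↓ Γ α (Δ , Δ⊆Γ , σΔ , Δ' , Δ'⊆Δ , ϱΔ' , ⊢Δ') =
  Δ' , ⊆-trans {i = Δ'} {j = Δ} {k = Γ} Δ'⊆Δ Δ⊆Γ , ϱΔ' , companion-self ⊢ σ (σ↓ Δ Δ' α σΔ Δ'⊆Δ) ⊢Δ'

companion-swap : ∀ {a ℓ t r s} {L : Set a} (⊢ : Rel𝒫 L ℓ t) (ϱ : Rel𝒫 L ℓ r) (σ : Rel𝒫 L ℓ s)
  → DownwardDirected ϱ → DownwardDirected σ → companion (companion ⊢ ϱ) σ ≐ᴿ companion (companion ⊢ σ) ϱ
companion-swap ⊢ ϱ σ ϱ↓ σ↓ = companion-swap-⊆ ⊢ ϱ σ σ↓ , companion-swap-⊆ ⊢ σ ϱ ϱ↓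

mainTheorem8 : ∀ {a ℓ t r s} {L : Set a} (⊢ : Rel𝒫 L ℓ t) (ϱ : Rel𝒫 L ℓ r) (σ : Rel𝒫 L ℓ s)
    → (DownwardDirected σ → companion (companion ⊢ ϱ) σ ⊆ᴿ companion (companion ⊢ σ) ϱ)
    × (DownwardDirected ϱ → DownwardDirected σ → companion (companion ⊢ ϱ) σ ≐ᴿ companion (companion ⊢ σ) ϱ)
mainTheorem8 ⊢ ϱ σ = companion-swap-⊆ ⊢ ϱ σ , companion-swap ⊢ ϱ σ
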